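{- For the square game on the square grid with $n$ winning sets, $\mathrm{SC}(\mathcal G_{\square},3)\ge \frac{2n}{15}-o(n)$.
   Context: An $s$-of-$k$ game on a $k$-uniform hypergraph $(V,\mathcal F)$ (winning sets are $k$-element subsets of the finite set $V$), $1\le s\le k$: Maker and Breaker alternately claim unclaimed vertices, Maker first, until all are claimed; the score is the number of winning sets in which Maker claimed at least $s$ vertices (Maker maximizes, Breaker minimizes). $\mathrm{SC}(\mathcal H,s)$ is the score under optimal play of both players. $\mathcal G_{\square}$ is the hypergraph whose vertices are the points of a finite portion of the square lattice and whose winning sets are the sets of four corners of the unit square faces, so $k=4$. Grids are assumed "two-dimensional": the number of winning sets within constant distance of the boundary is $o(n)$, where $n$ is the number of winning sets; $o(n)$ refers to $n\to\infty$. -}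

module Defs where

open import Data.Nat using (ℕ; zero; suc; _+_; _*_; _≤_; _≤?_; _⊔_; _⊓_)
open import Data.Integer as ℤ using (ℤ)
open import Data.Bool using (Bool; true; false)
open import Data.Product using (_×_; _,_)
open import Data.Product.Properties using (≡-dec)
open import Data.List using (List; []; _∷_; map; filter; length; foldr; concatMap; upTo; allFin)
open import Data.List.Relation.Unary.All using (All)
open import Data.List.Relation.Unary.Unique.Propositional using (Unique)
open import Relation.Binary.Definitions using (DecidableEquality)
open import Relation.Nullary using (¬_)
import Data.List.Membership.DecPropositional as DecMem

-- Generic s-of-k Maker-Breaker scoring game on a hypergraph (V, F).
-- Vertices: a list V (without repetitions), winning sets: a list of lists.

module Game {A : Set} (_≟_ : DecidableEquality A) where
  open DecMem _≟_ using (_∈?_)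

  hits : List A → List A → ℕ
  hits M F = length (filter (λ x → x ∈? M) F)

  finalScore : List (List A) → ℕ → List A → ℕ
  finalScore Fs s M = length (filter (λ F → s ≤? hits M F) Fs)

  picks : List A → List (A × List A)
  picks [] = []
  picks (x ∷ xs) = (x , xs) ∷ map (λ { (y , r) → y , x ∷ r }) (picks xs)

  maxOf minOf : ℕ → List ℕ → ℕ
  maxOf d [] = d
  maxOf d (x ∷ xs) = foldr _⊔_ x xs
  minOf d [] = d
  minOf d (x ∷ xs) = foldr _⊓_ x xs

  -- value of the position under optimal play.
  -- fuel ≥ number of unclaimed vertices; makerTurn says who moves;
  -- M = Maker's vertices so far, U = unclaimed vertices.
  value : List (List A) → ℕ → ℕ → Bool → List A → List A → ℕ
  value Fs s zero t M U = finalScore Fs s M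
  value Fs s (suc f) t M [] = finalScore Fs s M
  value Fs s (suc f) true M (u ∷ us) =
    maxOf 0 (map (λ { (x , r) → value Fs s f false (x ∷ M) r }) (picks (u ∷ us)))
  value Fs s (suc f) false M (u ∷ us) =
    minOf 0 (map (λ { (x , r) → value Fs s f true M r }) (picks (u ∷ us)))

  SC : (V : List A) → List (List A) → ℕ → ℕ
  SC V Fs s = value Fs s (length V) true [] V

Point : Set
Point = ℤ × ℤ

_≟P_ : DecidableEquality Point
_≟P_ = ≡-dec ℤ._≟_ ℤ._≟_

open DecMem _≟P_ using (_∈?_)
open Game _≟P_ public

record Grid : Set where
  constructor grid
  field
    pts    : List Point
    unique : Unique pts
open Grid public

corners : Point → List Point
corners (x , y) = (x , y) ∷ (x ℤ.+ ℤ.1ℤ , y) ∷ (x , y ℤ.+ ℤ.1ℤ) ∷ (x ℤ.+ ℤ.1ℤ , y ℤ.+ ℤ.1ℤ) ∷ []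

squareCorners : Grid → List Point
squareCorners G = filter (λ p → Data.List.Relation.Unary.All.all? (λ q → q ∈? pts G) (corners p)) (pts G)

squares : Grid → List (List Point)
squares G = map corners (squareCorners G)

nSq : Grid → ℕ
nSq G = length (squares G)

SCsq : Grid → ℕ → ℕ
SCsq G s = SC (pts G) (squares G) s

offsets : ℕ → List ℤ
offsets d = map (λ i → ℤ.+ i ℤ.- ℤ.+ d) (upTo (2 * d + 2))

-- the box of lattice points at l∞-distance ≤ d from the unit square at p
box : ℕ → Point → List Point
box d (x , y) = concatMap (λ a → map (λ b → (x ℤ.+ a , y ℤ.+ b)) (offsets d)) (offsets d)

-- number of winning sets within distance d of the boundary:
-- squares whose d-neighbourhood is not entirely contained in the grid
nearBoundary : ℕ → Grid → ℕ
nearBoundary d G =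
  length (filter (λ p → Relation.Nullary.¬? (Data.List.Relation.Unary.All.all? (λ q → q ∈? pts G) (box d p))) (squareCorners G))

-- Cut the lattice into 5 × 3 blocks and charge to each block the 15 unit squares whose lower-left
-- corner lies in it. In the game played on a single block, with Breaker moving first, Maker can get
-- three corners of two of the eight unit squares inside the block: a certificate, checked by
-- evaluation, gives Maker's answers to Breaker's first moves and ends in pairing strategies. Maker
-- plays this local strategy in every block at once, answering each Breaker move in Breaker's block
-- and moving arbitrarily when no answer is needed; extra Maker vertices never hurt. So each block
-- containing an interior square yields two winning sets for the at most 15 interior squares charged
-- to it, and all other squares lie within distance 4 of the boundary.

module Submission where

open import Defs hiding (hits; finalScore; picks; maxOf; minOf; value; SC)
open import Data.Bool using (true; false; if_then_else_)
open import Data.Empty using (⊥; ⊥-elim)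
open import Data.Fin using (Fin; #_; toℕ; fromℕ<; combine; quotient; remainder; inject₁; suc) renaming (_≟_ to _≟ᶠ_)
open import Data.Fin.Properties
  using (all?; any?; toℕ<n; toℕ-fromℕ<; toℕ-injective; toℕ-inject₁; inject₁-injective;
         remQuot-combine; combine-remQuot; combine-injective)
open import Data.Integer as ℤ using (ℤ; +_; ∣_∣; _⊖_; 0ℤ)
open import Data.Integer.DivMod using (_/ℕ_; _%ℕ_; a≡a%ℕn+[a/ℕn]*n; n%ℕd<d)
import Data.Integer.Properties as ℤ
import Data.Integer.Tactic.RingSolver as ℤ-Solver
open import Data.List using (List; []; _∷_; _++_; map; filter; length; allFin)
open import Data.List.Properties using (length-++; length-map; length-tabulate; filter-≐)
open import Data.List.Membership.Propositional using (_∈_; _∉_)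
open import Data.List.Membership.Propositional.Properties
  using (∈-map⁺; ∈-map⁻; ∈-filter⁺; ∈-filter⁻; ∈-∃++; ∈-++⁻; ∈-++⁺ˡ; ∈-++⁺ʳ; ∈-concat⁺′; ∈-upTo⁺;
         ∈-allFin)
import Data.List.Membership.DecPropositional as DecMembership
open import Data.List.Relation.Unary.Any using (here; there)
open import Data.List.Relation.Unary.All as All using (All; []; _∷_)
import Data.List.Relation.Unary.All.Properties as All
open import Data.List.Relation.Unary.Unique.Propositional using (Unique; _∷_)
import Data.List.Relation.Unary.Unique.Propositional.Properties as Unique
open import Data.List.Relation.Binary.Subset.Propositional using (_⊆_)
open import Data.List.Relation.Binary.Sublist.Propositional using (⊆-refl)
import Data.List.Relation.Binary.Sublist.Propositional.Properties as Sublist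
open import Data.List.Relation.Binary.Permutation.Propositional using (_↭_; prep; swap; ↭-refl; ↭-trans; ↭-sym)
open import Data.List.Relation.Binary.Permutation.Propositional.Properties using (↭-length; ∈-resp-↭)
open import Data.Maybe using (Maybe; just; nothing)
open import Data.Maybe.Properties using () renaming (≡-dec to ≡-decᵐ)
import Data.Maybe.Relation.Unary.All as Maybe
open import Data.Nat using (ℕ; zero; suc; pred; _+_; _*_; _∸_; _≤_; _<_; _≤?_; z≤n; s≤s; NonZero)
open import Data.Nat.Properties
  using (≤-refl; ≤-reflexive; ≤-trans; ≤-pred; ≤-<-trans; n≤1+n; n<1⇒n≡0; m≤n+m; m<m+n; m∸n≤m; ⊔-lub;
         +-suc; +-identityʳ; +-mono-≤; +-monoˡ-≤; +-monoʳ-≤; *-monoʳ-≤; *-comm; *-zeroʳ; *-identityˡ;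
         *-distribˡ-+; *-cancelʳ-<; m≤m⊔n; m≤n⊔m; ⊓-sel; m≤n*m; module ≤-Reasoning)
import Data.Nat.Tactic.RingSolver as ℕ-Solver
open import Data.Product using (∃; ∃₂; ∃-syntax; _×_; _,_; proj₁; proj₂)
open import Data.Product.Properties using (≡-dec)
open import Data.Sum using (_⊎_; inj₁; inj₂)
open import Data.Vec.Functional using (Vector; updateAt)
open import Data.Vec.Functional.Properties using (updateAt-updates; updateAt-minimal)
open import Function using (_∘_; id; const; _⇔_; mk⇔)
open import Level using (0ℓ)
open import Relation.Binary.Definitions using (DecidableEquality)
open import Relation.Binary.PropositionalEquality
  using (_≡_; _≢_; _≗_; refl; sym; trans; cong; cong₂; subst; subst₂; module ≡-Reasoning)
open import Relation.Nullary using (Dec; yes; no; contradiction; does)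
open import Relation.Nullary.Decidable using (_×-dec_; _→-dec_; ¬?; map′; from-yes; dec-true; dec-false; does-⇔)
open import Relation.Unary using (Pred; Decidable)

module _ {X : Set} where

  distinct-∈⇒2≤length : ∀ {a b : X} {xs} → a ∈ xs → b ∈ xs → a ≢ b → 2 ≤ length xs
  distinct-∈⇒2≤length (here refl) (here refl) a≢b = ⊥-elim (a≢b refl)
  distinct-∈⇒2≤length {xs = _ ∷ _ ∷ _} (here refl) (there _) _ = s≤s (s≤s z≤n)
  distinct-∈⇒2≤length {xs = _ ∷ _ ∷ _} (there _) (here refl) _ = s≤s (s≤s z≤n)
  distinct-∈⇒2≤length (there a∈) (there b∈) a≢b = ≤-trans (distinct-∈⇒2≤length a∈ b∈ a≢b) (n≤1+n _)

  Unique-⊆⇒length≤ : {xs ys : List X} → Unique xs → xs ⊆ ys → length xs ≤ length ys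
  Unique-⊆⇒length≤ {[]} _ _ = z≤n
  Unique-⊆⇒length≤ {x ∷ xs} {ys} (x∉xs ∷ xs!) xs⊆ys with ∈-∃++ (xs⊆ys (here refl))
  ... | ys₁ , ys₂ , refl = begin
      suc (length xs)                  ≤⟨ s≤s (Unique-⊆⇒length≤ xs! xs⊆ys₁++ys₂) ⟩
      suc (length (ys₁ ++ ys₂))        ≡⟨ cong suc (length-++ ys₁) ⟩
      suc (length ys₁ + length ys₂)    ≡⟨ sym (+-suc (length ys₁) (length ys₂)) ⟩
      length ys₁ + length (x ∷ ys₂)    ≡⟨ sym (length-++ ys₁) ⟩
      length (ys₁ ++ x ∷ ys₂)          ∎
    where
    open ≤-Reasoning
    xs⊆ys₁++ys₂ : xs ⊆ ys₁ ++ ys₂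
    xs⊆ys₁++ys₂ z∈xs with ∈-++⁻ ys₁ (xs⊆ys (there z∈xs))
    ... | inj₁ z∈ys₁ = ∈-++⁺ˡ z∈ys₁
    ... | inj₂ (here refl) = ⊥-elim (All.lookup x∉xs z∈xs refl)
    ... | inj₂ (there z∈ys₂) = ∈-++⁺ʳ ys₁ z∈ys₂

  module _ {P : Pred X 0ℓ} (P? : Decidable P) where

    length-filter+filter-¬ : ∀ xs → length xs ≡ length (filter P? xs) + length (filter (¬? ∘ P?) xs)
    length-filter+filter-¬ [] = refl
    length-filter+filter-¬ (x ∷ xs) with P? x
    ... | yes _ = cong suc (length-filter+filter-¬ xs)
    ... | no _ = trans (cong suc (length-filter+filter-¬ xs)) (sym (+-suc _ _))

    module _ {Q : Pred X 0ℓ} (Q? : Decidable Q) where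

      filter-filter-⊇ : (∀ {x} → P x → Q x) → ∀ xs → filter P? (filter Q? xs) ≡ filter P? xs
      filter-filter-⊇ P⇒Q [] = refl
      filter-filter-⊇ P⇒Q (x ∷ xs) with Q? x
      ... | yes _ with P? x
      ...   | yes _ = cong (x ∷_) (filter-filter-⊇ P⇒Q xs)
      ...   | no _ = filter-filter-⊇ P⇒Q xs
      filter-filter-⊇ P⇒Q (x ∷ xs) | no ¬q with P? x
      ...   | yes p = ⊥-elim (¬q (P⇒Q p))
      ...   | no _ = filter-filter-⊇ P⇒Q xs

      length-filter-filter≤ : ∀ xs → length (filter P? (filter Q? xs)) ≤ length (filter P? xs)
      length-filter-filter≤ xs = Sublist.length-mono-≤ (Sublist.filter⁺ P? P? (λ { refl p → p }) (Sublist.filter-⊆ Q? xs))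

module _ {X T : Set} (tile : X → T) (_≟_ : DecidableEquality T) where

  inTile : T → List X → List X
  inTile t = filter (λ x → tile x ≟ t)

  outsideTile : T → List X → List X
  outsideTile t = filter (λ x → ¬? (tile x ≟ t))

  -- Remove the tile of the first element of A from both lists and recurse.
  double-counting : ∀ p q (A B : List X) →
    (∀ {a} → a ∈ A → p ≤ length (inTile (tile a) B)) →
    (∀ t → length (inTile t A) ≤ q) →
    p * length A ≤ q * length B
  double-counting p q A B = go (length A) A B ≤-refl
    where
    go : ∀ n A B → length A ≤ n →
      (∀ {a} → a ∈ A → p ≤ length (inTile (tile a) B)) →
      (∀ t → length (inTile t A) ≤ q) →
      p * length A ≤ q * length B
    go _ [] B _ _ _ = subst (_≤ q * length B) (sym (*-zeroʳ p)) z≤n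
    go zero (_ ∷ _) _ () _ _
    go (suc n) A@(a ∷ _) B |A|≤1+n many few = begin
        p * length A                                  ≡⟨ cong (p *_) (length-filter+filter-¬ (λ x → tile x ≟ t) A) ⟩
        p * (length (inTile t A) + length A′)         ≡⟨ *-distribˡ-+ p _ _ ⟩
        p * length (inTile t A) + p * length A′       ≤⟨ +-mono-≤ here′ (go n A′ B′ |A′|≤n many′ few′) ⟩
        q * length (inTile t B) + q * length B′       ≡⟨ sym (*-distribˡ-+ q _ _) ⟩
        q * (length (inTile t B) + length B′)         ≡⟨ cong (q *_) (sym (length-filter+filter-¬ (λ x → tile x ≟ t) B)) ⟩
        q * length B                                  ∎
      where
      open ≤-Reasoning
      t : T
      t = tile a
      A′ B′ : List X
      A′ = outsideTile t A
      B′ = outsideTile t B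
      here′ : p * length (inTile t A) ≤ q * length (inTile t B)
      here′ = ≤-trans (*-monoʳ-≤ p (few t)) (≤-trans (≤-reflexive (*-comm p q)) (*-monoʳ-≤ q (many (here refl))))
      |A′|≤n : length A′ ≤ n
      |A′|≤n with inTile t A | ∈-filter⁺ (λ x → tile x ≟ t) {xs = A} (here refl) refl
                | length-filter+filter-¬ (λ x → tile x ≟ t) A
      ... | _ ∷ _ | _ | |A|≡ = ≤-pred (≤-trans (+-monoˡ-≤ (length A′) (s≤s z≤n)) (subst (_≤ suc n) |A|≡ |A|≤1+n))
      many′ : ∀ {a′} → a′ ∈ A′ → p ≤ length (inTile (tile a′) B′)
      many′ {a′} a′∈A′ with ∈-filter⁻ (λ x → ¬? (tile x ≟ t)) {xs = A} a′∈A′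
      ... | a′∈A , a′∉t = subst (p ≤_) (cong length (sym (filter-filter-⊇ (λ x → tile x ≟ tile a′)
              (λ x → ¬? (tile x ≟ t)) (λ tx≡ta′ tx≡t → a′∉t (trans (sym tx≡ta′) tx≡t)) B))) (many a′∈A)
      few′ : ∀ t′ → length (inTile t′ A′) ≤ q
      few′ t′ = ≤-trans (length-filter-filter≤ (λ x → tile x ≟ t′) (λ x → ¬? (tile x ≟ t)) A) (few t′)

module _ {X Y : Set} (f : X → Y) {P : Pred Y 0ℓ} (P? : Decidable P) where

  length-filter-map : ∀ xs → length (filter P? (map f xs)) ≡ length (filter (P? ∘ f) xs)
  length-filter-map [] = refl
  length-filter-map (x ∷ xs) with P? (f x)
  ... | yes _ = cong suc (length-filter-map xs)
  ... | no _ = length-filter-map xs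

module GameValue {A : Set} (_≟_ : DecidableEquality A) where

  open Game _≟_ public

  picks-↭ : ∀ {U x r} → (x , r) ∈ picks U → U ↭ x ∷ r
  picks-↭ {_ ∷ _} (here refl) = ↭-refl
  picks-↭ {u ∷ us} (there xr∈) with ∈-map⁻ _ xr∈
  ... | (x , r) , xr∈′ , refl = ↭-trans (prep u (picks-↭ xr∈′)) (swap u x ↭-refl)

  picked∈ : ∀ {U x r} → (x , r) ∈ picks U → x ∈ U
  picked∈ xr∈ = ∈-resp-↭ (↭-sym (picks-↭ xr∈)) (here refl)

  ∈-picks⇔ : ∀ {U x r p} → (x , r) ∈ picks U → p ≢ x → p ∈ r ⇔ p ∈ U
  ∈-picks⇔ {x = x} {r} {p} xr∈ p≢x = mk⇔ (λ p∈r → ∈-resp-↭ (↭-sym (picks-↭ xr∈)) (there p∈r))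
    (λ p∈U → drop-head (∈-resp-↭ (picks-↭ xr∈) p∈U))
    where
    drop-head : p ∈ x ∷ r → p ∈ r
    drop-head (here p≡x) = contradiction p≡x p≢x
    drop-head (there p∈r) = p∈r

  ∈⇒∈-picks : ∀ {x U} → x ∈ U → ∃ λ r → (x , r) ∈ picks U
  ∈⇒∈-picks {U = _ ∷ us} (here refl) = us , here refl
  ∈⇒∈-picks {U = u ∷ _} (there x∈) with ∈⇒∈-picks x∈
  ... | r , xr∈ = u ∷ r , there (∈-map⁺ _ xr∈)

  ∈⇒≤maxOf : ∀ {y x xs} d → y ∈ x ∷ xs → y ≤ maxOf d (x ∷ xs)
  ∈⇒≤maxOf {xs = []} d (here refl) = ≤-refl
  ∈⇒≤maxOf {xs = z ∷ zs} d (here refl) = ≤-trans (∈⇒≤maxOf {xs = zs} d (here refl)) (m≤n⊔m z _)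
  ∈⇒≤maxOf {xs = z ∷ zs} d (there (here refl)) = m≤m⊔n z _
  ∈⇒≤maxOf {xs = z ∷ zs} d (there (there y∈)) = ≤-trans (∈⇒≤maxOf {xs = zs} d (there y∈)) (m≤n⊔m z _)

  minOf∈ : ∀ d x xs → minOf d (x ∷ xs) ∈ x ∷ xs
  minOf∈ d x [] = here refl
  minOf∈ d x (z ∷ zs) with ⊓-sel z (minOf d (x ∷ zs)) | minOf∈ d x zs
  ... | inj₁ ≡z | _ rewrite ≡z = there (here refl)
  ... | inj₂ ≡m | here m≡x rewrite ≡m = here m≡x
  ... | inj₂ ≡m | there m∈zs rewrite ≡m = there (there m∈zs)

  -- Positions are pairs (Maker's vertices, unclaimed vertices).
  record MakerStrategy (Fs : List (List A)) (s : ℕ) (Good : ℕ → Set) : Set₁ where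
    field
      MakerToMove BreakerToMove : List A → List A → Set
      maker-move : ∀ {M u us} → MakerToMove M (u ∷ us) →
        ∃₂ λ x r → (x , r) ∈ picks (u ∷ us) × BreakerToMove (x ∷ M) r
      breaker-move : ∀ {M U y r} → (y , r) ∈ picks U → BreakerToMove M U → MakerToMove M r
      maker-end : ∀ {M} → MakerToMove M [] → Good (finalScore Fs s M)
      breaker-end : ∀ {M} → BreakerToMove M [] → Good (finalScore Fs s M)
      Good-mono : ∀ {m n} → m ≤ n → Good m → Good n

    value-bound : ∀ f M U → length U ≤ f →
      (MakerToMove M U → Good (value Fs s f true M U)) × (BreakerToMove M U → Good (value Fs s f false M U))
    value-bound zero M [] _ = maker-end , breaker-end
    value-bound (suc f) M [] _ = maker-end , breaker-end
    value-bound (suc f) M (u ∷ us) (s≤s |us|≤f) = maker , breaker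
      where
      |r|≤f : ∀ {x r} → (x , r) ∈ picks (u ∷ us) → length r ≤ f
      |r|≤f xr∈ = subst (_≤ f) (cong pred (↭-length (picks-↭ xr∈))) |us|≤f
      maker : MakerToMove M (u ∷ us) → Good (value Fs s (suc f) true M (u ∷ us))
      maker m with maker-move m
      ... | x , r , xr∈ , b = Good-mono (∈⇒≤maxOf 0 (∈-map⁺ (λ p → value Fs s f false (proj₁ p ∷ M) (proj₂ p)) xr∈))
                                  (proj₂ (value-bound f (x ∷ M) r (|r|≤f xr∈)) b)
      breaker : BreakerToMove M (u ∷ us) → Good (value Fs s (suc f) false M (u ∷ us))
      breaker b with ∈-map⁻ (λ p → value Fs s f true M (proj₂ p)) (minOf∈ 0 _ _)
      ... | (y , r) , yr∈ , min≡ = subst Good (sym min≡) (proj₁ (value-bound f M r (|r|≤f yr∈)) (breaker-move yr∈ b))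

    SC-bound : ∀ V → MakerToMove [] V → Good (SC V Fs s)
    SC-bound V = proj₁ (value-bound (length V) [] V ≤-refl)

data Cell : Set where
  maker breaker free : Cell

_≟ᶜ_ : DecidableEquality Cell
maker ≟ᶜ maker = yes refl
breaker ≟ᶜ breaker = yes refl
free ≟ᶜ free = yes refl
maker ≟ᶜ breaker = no λ ()
maker ≟ᶜ free = no λ ()
breaker ≟ᶜ maker = no λ ()
breaker ≟ᶜ free = no λ ()
free ≟ᶜ maker = no λ ()
free ≟ᶜ breaker = no λ ()

State : ℕ → Set
State = Vector Cell

module _ {n : ℕ} where

  infixl 6 _[_]≔_
  _[_]≔_ : State n → Fin n → Cell → State n
  s [ i ]≔ c = updateAt s i (const c)

  []≔-updates : ∀ (s : State n) i c → (s [ i ]≔ c) i ≡ c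
  []≔-updates s i c = updateAt-updates i s

  []≔-minimal : ∀ (s : State n) {i j} c → j ≢ i → (s [ i ]≔ c) j ≡ s j
  []≔-minimal s c j≢i = updateAt-minimal _ _ s j≢i

  infix 4 _⊆ᵐ_
  _⊆ᵐ_ : State n → State n → Set
  s ⊆ᵐ s′ = ∀ {i} → s i ≡ maker → s′ i ≡ maker

infix 4 _≼_
data _≼_ : Cell → Cell → Set where
  ≼-refl : ∀ {c} → c ≼ c
  ≼-maker : ∀ {c} → c ≼ maker

free-≼ : ∀ {c} → free ≼ c → c ≡ free ⊎ c ≡ maker
free-≼ ≼-refl = inj₁ refl
free-≼ ≼-maker = inj₂ refl

≼-free : ∀ {c} → c ≼ free → c ≡ free
≼-free ≼-refl = refl

≼-trans : ∀ {a b c} → a ≼ b → b ≼ c → a ≼ c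
≼-trans ≼-refl b≼c = b≼c
≼-trans ≼-maker ≼-refl = ≼-maker
≼-trans ≼-maker ≼-maker = ≼-maker

≡⇒≼ : ∀ {a b} → a ≡ b → a ≼ b
≡⇒≼ refl = ≼-refl

≼-maker⇒ : ∀ {a b} → a ≼ b → a ≡ maker → b ≡ maker
≼-maker⇒ ≼-refl a≡maker = a≡maker
≼-maker⇒ ≼-maker _ = refl

module _ {n : ℕ} where

  infix 4 _⊑_
  _⊑_ : State n → State n → Set
  s ⊑ s′ = ∀ i → s i ≼ s′ i

  ⊑⇒⊆ᵐ : ∀ {s s′} → s ⊑ s′ → s ⊆ᵐ s′
  ⊑⇒⊆ᵐ s⊑s′ {i} = ≼-maker⇒ (s⊑s′ i)

  ⊑-update : ∀ {s s′} i c → s ⊑ s′ → s [ i ]≔ c ⊑ s′ [ i ]≔ c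
  ⊑-update {s} {s′} i c s⊑s′ j with j ≟ᶠ i
  ... | yes refl rewrite []≔-updates s j c | []≔-updates s′ j c = ≼-refl
  ... | no j≢i rewrite []≔-minimal s c j≢i | []≔-minimal s′ c j≢i = s⊑s′ j

  ≗⇒⊑ : ∀ {s s′ : State n} → s ≗ s′ → s ⊑ s′
  ≗⇒⊑ s≗s′ i = ≡⇒≼ (s≗s′ i)

  ⊑-[]≔ : ∀ {s s′ : State n} {i c} → (∀ {j} → j ≢ i → s j ≼ s′ j) → c ≼ s′ i → s [ i ]≔ c ⊑ s′
  ⊑-[]≔ {s} {s′} {i} {c} elsewhere c≼s′ᵢ j with j ≟ᶠ i
  ... | yes refl rewrite []≔-updates s j c = c≼s′ᵢ
  ... | no j≢i rewrite []≔-minimal s c j≢i = elsewhere j≢i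

  ⊑-update-maker : ∀ {s s′ : State n} i c → s ⊑ s′ → s′ i ≡ maker → s [ i ]≔ c ⊑ s′
  ⊑-update-maker i c s⊑s′ s′ᵢ≡maker = ⊑-[]≔ (λ {j} _ → s⊑s′ j) (subst (c ≼_) (sym s′ᵢ≡maker) ≼-maker)

  ⊑-claim : ∀ (s : State n) i → s ⊑ s [ i ]≔ maker
  ⊑-claim s i j with j ≟ᶠ i
  ... | yes refl rewrite []≔-updates s j maker = ≼-maker
  ... | no j≢i rewrite []≔-minimal s maker j≢i = ≼-refl

  []≔-≼ : ∀ (s : State n) {i j} c → j ≢ i → s j ≼ (s [ i ]≔ c) j
  []≔-≼ s c j≢i = ≡⇒≼ (sym ([]≔-minimal s c j≢i))

  ⊆ᵐ-[]≔ : ∀ {s : State n} {i} c → s i ≢ maker → s ⊆ᵐ s [ i ]≔ c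
  ⊆ᵐ-[]≔ {s} {i} c sᵢ≢maker {j} sⱼ≡maker with j ≟ᶠ i
  ... | yes refl = contradiction sⱼ≡maker sᵢ≢maker
  ... | no j≢i = trans ([]≔-minimal s c j≢i) sⱼ≡maker

data Intact : Cell → Cell → Set where
  left : ∀ {c} → Intact maker c
  right : ∀ {c} → Intact c maker
  both-free : Intact free free

intact? : ∀ a b → Dec (Intact a b)
intact? maker _ = yes left
intact? _ maker = yes right
intact? free free = yes both-free
intact? breaker breaker = no λ ()
intact? breaker free = no λ ()
intact? free breaker = no λ ()

Intact-mono : ∀ {a a′ b b′} → a ≼ a′ → b ≼ b′ → Intact a b → Intact a′ b′
Intact-mono ≼-maker _ _ = left
Intact-mono ≼-refl ≼-maker _ = right
Intact-mono ≼-refl ≼-refl ab = ab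

Intact-free : ∀ {c} → Intact free c → c ≡ maker ⊎ c ≡ free
Intact-free right = inj₁ refl
Intact-free both-free = inj₂ refl

Intact-taken : ∀ {a b} → Intact a b → a ≢ free → b ≢ free → a ≡ maker ⊎ b ≡ maker
Intact-taken left _ _ = inj₁ refl
Intact-taken right _ _ = inj₂ refl
Intact-taken both-free a≢free _ = contradiction refl a≢free

module LocalGame {n : ℕ} (Won : State n → Set) (Won-mono : ∀ {s s′} → s ⊆ᵐ s′ → Won s → Won s′)
                 (won? : ∀ s → Dec (Won s)) where

  open DecMembership (_≟ᶠ_ {n}) using (_∈?_)

  Full : State n → Set
  Full s = ∀ i → s i ≢ free

  Pairs : Set
  Pairs = List (Fin n × Fin n)

  partner : Pairs → Fin n → Maybe (Fin n)
  partner [] i = nothing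
  partner ((a , b) ∷ ps) i with i ≟ᶠ a | i ≟ᶠ b
  ... | yes _ | _ = just b
  ... | no _ | yes _ = just a
  ... | no _ | no _ = partner ps i

  Symmetric : Pairs → Set
  Symmetric ps = ∀ i → Maybe.All (λ j → j ≢ i × partner ps j ≡ just i) (partner ps i)

  PairedIn : Pairs → Fin n × Fin n → Set
  PairedIn ps (a , b) = partner ps a ≡ just b

  Listed : Pairs → Set
  Listed ps = All (PairedIn ps) ps

  IntactPair : State n → Fin n × Fin n → Set
  IntactPair s (a , b) = Intact (s a) (s b)

  makerOn : List (Fin n) → State n
  makerOn R i with i ∈? R
  ... | yes _ = maker
  ... | no _ = breaker

  EveryChoiceWins : List (Fin n) → Pairs → Set
  EveryChoiceWins R [] = Won (makerOn R)
  EveryChoiceWins R ((a , b) ∷ ps) = EveryChoiceWins (a ∷ R) ps × EveryChoiceWins (b ∷ R) ps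

  -- A pairing strategy: Maker holds the cells R and answers a Breaker move in a pair by taking the other cell.
  record ValidPairing (R : List (Fin n)) (ps : Pairs) : Set where
    constructor valid
    field
      symmetric : Symmetric ps
      listed : Listed ps
      choices-win : EveryChoiceWins R ps

  record Respects (R : List (Fin n)) (ps : Pairs) (s : State n) : Set where
    constructor respects
    field
      claimed-maker : ∀ {i} → i ∈ R → s i ≡ maker
      partners-intact : ∀ i → Maybe.All (λ j → Intact (s i) (s j)) (partner ps i)
  open Respects
  open ValidPairing

  -- Secured: Breaker is to move and Maker can force Won; Securable: the same with Maker to move.
  mutual
    data Secured (s : State n) : Set where
      paired : ∀ {R ps} → ValidPairing R ps → Respects R ps s → Secured s
      won : Won s → Secured s
      branch : (∃ λ i → s i ≡ free) → (∀ {y} → s y ≡ free → Securable (s [ y ]≔ breaker)) → Secured s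

    data Securable (s : State n) : Set where
      secured : Secured s → Securable s
      claim : ∀ {x} → s x ≡ free → Secured (s [ x ]≔ maker) → Securable s

  makerOn-⊆ᵐ : ∀ {R s} → (∀ {i} → i ∈ R → s i ≡ maker) → makerOn R ⊆ᵐ s
  makerOn-⊆ᵐ {R} R⊆makers {i} with i ∈? R
  ... | yes i∈R = λ _ → R⊆makers i∈R

  EveryChoiceWins-full : ∀ {s} → Full s → ∀ R qs → EveryChoiceWins R qs →
    (∀ {i} → i ∈ R → s i ≡ maker) → All (IntactPair s) qs → Won s
  EveryChoiceWins-full full R [] w R⊆makers [] = Won-mono (makerOn-⊆ᵐ R⊆makers) w
  EveryChoiceWins-full {s} full R ((a , b) ∷ qs) (wa , wb) R⊆makers (ab ∷ qs-intact)
    with Intact-taken ab (full a) (full b)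
  ... | inj₁ sa≡maker =
    EveryChoiceWins-full full (a ∷ R) qs wa (λ { (here refl) → sa≡maker ; (there i∈R) → R⊆makers i∈R }) qs-intact
  ... | inj₂ sb≡maker =
    EveryChoiceWins-full full (b ∷ R) qs wb (λ { (here refl) → sb≡maker ; (there i∈R) → R⊆makers i∈R }) qs-intact

  listed-intact : ∀ {R ps s} → Respects R ps s → ∀ {qs} → All (PairedIn ps) qs → All (IntactPair s) qs
  listed-intact resp [] = []
  listed-intact {s = s} resp {(a , b) ∷ _} (a↦b ∷ listed) =
    Maybe.drop-just (subst (Maybe.All (λ j → Intact (s a) (s j))) a↦b (partners-intact resp a)) ∷ listed-intact resp listed

  paired-full : ∀ {R ps s} → Full s → ValidPairing R ps → Respects R ps s → Won s
  paired-full full (valid _ listed wins) resp =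
    EveryChoiceWins-full full _ _ wins (claimed-maker resp) (listed-intact resp listed)

  Secured-full : ∀ {s} → Full s → Secured s → Won s
  Secured-full full (paired v resp) = paired-full full v resp
  Secured-full full (won w) = w
  Secured-full full (branch (i , sᵢ≡free) _) = contradiction sᵢ≡free (full i)

  Securable-full : ∀ {s} → Full s → Securable s → Won s
  Securable-full full (secured g) = Secured-full full g
  Securable-full full (claim {x} sₓ≡free _) = contradiction sₓ≡free (full x)

  Respects-mono : ∀ {R ps s s′} → s ⊑ s′ → Respects R ps s → Respects R ps s′
  Respects-mono s⊑s′ resp = respects
    (λ i∈R → ⊑⇒⊆ᵐ s⊑s′ (claimed-maker resp i∈R))
    (λ i → Maybe.map (λ {j} → Intact-mono (s⊑s′ i) (s⊑s′ j)) (partners-intact resp i))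

  mutual
    Secured-mono : ∀ {s s′} → s ⊑ s′ → Secured s → Secured s′
    Secured-mono s⊑s′ (paired v resp) = paired v (Respects-mono s⊑s′ resp)
    Secured-mono s⊑s′ (won w) = won (Won-mono (⊑⇒⊆ᵐ s⊑s′) w)
    Secured-mono {s′ = s′} s⊑s′ (branch (i , sᵢ≡free) next) with any? (λ j → s′ j ≟ᶜ free)
    ... | yes free′ = branch free′ λ {y} s′y≡free →
            Securable-mono (⊑-update y breaker s⊑s′) (next (≼-free (subst (_ ≼_) s′y≡free (s⊑s′ y))))
    ... | no no-free′ with free-≼ (subst (_≼ s′ i) sᵢ≡free (s⊑s′ i))
    ...   | inj₁ s′ᵢ≡free = contradiction (i , s′ᵢ≡free) no-free′
    ...   | inj₂ s′ᵢ≡maker =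
            won (Securable-full (λ j s′j≡free → no-free′ (j , s′j≡free))
                  (Securable-mono (⊑-update-maker i breaker s⊑s′ s′ᵢ≡maker) (next sᵢ≡free)))

    Securable-mono : ∀ {s s′} → s ⊑ s′ → Securable s → Securable s′
    Securable-mono s⊑s′ (secured g) = secured (Secured-mono s⊑s′ g)
    Securable-mono {s′ = s′} s⊑s′ (claim {x} sₓ≡free g) with free-≼ (subst (_≼ s′ x) sₓ≡free (s⊑s′ x))
    ... | inj₁ s′ₓ≡free = claim s′ₓ≡free (Secured-mono (⊑-update x maker s⊑s′) g)
    ... | inj₂ s′ₓ≡maker = secured (Secured-mono (⊑-update-maker x maker s⊑s′ s′ₓ≡maker) g)

  symmetric-partner : ∀ ps {i j} → Symmetric ps → partner ps i ≡ just j → j ≢ i × partner ps j ≡ just i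
  symmetric-partner ps {i} ps-sym i↦j = Maybe.drop-just (subst (Maybe.All _) i↦j (ps-sym i))

  -- A Breaker move at a is harmless to the pairing once Maker holds the partner of a.
  Respects-breaker : ∀ {R ps s s′ a} → Symmetric ps → Respects R ps s → s a ≡ free →
    (∀ {i} → i ≢ a → s i ≼ s′ i) → Maybe.All (λ b → s′ b ≡ maker) (partner ps a) → Respects R ps s′
  Respects-breaker {R} {ps} {s} {s′} {a} ps-sym resp sa≡free agree partner-maker = respects claimed intact
    where
    claimed : ∀ {i} → i ∈ R → s′ i ≡ maker
    claimed {i} i∈R with i ≟ᶠ a | claimed-maker resp i∈R
    ... | yes refl | sa≡maker = contradiction (trans (sym sa≡maker) sa≡free) λ ()
    ... | no i≢a | sᵢ≡maker = ≼-maker⇒ (agree i≢a) sᵢ≡maker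
    intact : ∀ i → Maybe.All (λ j → Intact (s′ i) (s′ j)) (partner ps i)
    intact i with i ≟ᶠ a
    ... | yes refl = Maybe.map (λ s′ⱼ≡maker → subst (Intact _) (sym s′ⱼ≡maker) right) partner-maker
    ... | no i≢a with partner ps i in i↦ | partners-intact resp i
    ...   | nothing | _ = Maybe.nothing
    ...   | just j | Maybe.just sᵢsⱼ with j ≟ᶠ a
    ...     | no j≢a = Maybe.just (Intact-mono (agree i≢a) (agree j≢a) sᵢsⱼ)
    ...     | yes refl = Maybe.just (subst (λ c → Intact c (s′ j)) (sym s′ᵢ≡maker) left)
      where
      s′ᵢ≡maker : s′ i ≡ maker
      s′ᵢ≡maker = Maybe.drop-just (subst (Maybe.All _) (proj₂ (symmetric-partner ps ps-sym i↦)) partner-maker)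

  paired-breaker : ∀ {R ps s a} → ValidPairing R ps → Respects R ps s → s a ≡ free → Securable (s [ a ]≔ breaker)
  paired-breaker {ps = ps} {s} {a} v resp sa≡free with partner ps a in a↦ | partners-intact resp a
  ... | nothing | _ = secured (paired v (Respects-breaker {s′ = s [ a ]≔ breaker} (symmetric v) resp sa≡free
                        ([]≔-≼ s breaker) (subst (Maybe.All _) (sym a↦) Maybe.nothing)))
  ... | just b | Maybe.just sa-sb = answer (Intact-free (subst (λ c → Intact c (s b)) sa≡free sa-sb))
    where
    b≢a : b ≢ a
    b≢a = proj₁ (symmetric-partner ps (symmetric v) a↦)
    partner-maker : ∀ s′ → s′ b ≡ maker → Maybe.All (λ b′ → s′ b′ ≡ maker) (partner ps a)
    partner-maker s′ s′b≡maker = subst (Maybe.All _) (sym a↦) (Maybe.just s′b≡maker)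
    answer : s b ≡ maker ⊎ s b ≡ free → Securable (s [ a ]≔ breaker)
    answer (inj₁ sb≡maker) =
      secured (paired v (Respects-breaker (symmetric v) resp sa≡free ([]≔-≼ s breaker)
        (partner-maker (s [ a ]≔ breaker) (trans ([]≔-minimal s breaker b≢a) sb≡maker))))
    answer (inj₂ sb≡free) =
      claim (trans ([]≔-minimal s breaker b≢a) sb≡free)
        (paired v (Respects-breaker (symmetric v) resp sa≡free
          (λ i≢a → ≼-trans ([]≔-≼ s breaker i≢a) (⊑-claim (s [ a ]≔ breaker) b _))
          (partner-maker (s [ a ]≔ breaker [ b ]≔ maker) ([]≔-updates (s [ a ]≔ breaker) b maker))))

  Secured-breaker : ∀ {s a} → s a ≡ free → Secured s → Securable (s [ a ]≔ breaker)
  Secured-breaker sa≡free (paired v resp) = paired-breaker v resp sa≡free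
  Secured-breaker {s} {a} sa≡free (won w) =
    secured (won (Won-mono (⊆ᵐ-[]≔ {s = s} {a} breaker λ sa≡maker → contradiction (trans (sym sa≡maker) sa≡free) λ ()) w))
  Secured-breaker sa≡free (branch _ next) = next sa≡free

  data Certificate : Set where
    pairing : List (Fin n) → Pairs → Certificate
    respond : List (Fin n × Fin n × Certificate) → Certificate

  -- respond lists, for each Breaker move y, Maker's answer x and the certificate for the position after both moves.
  mutual
    Certifies : Certificate → State n → Set
    Certifies (pairing R ps) s = ValidPairing R ps × Respects R ps s
    Certifies (respond rs) s = (∃ λ i → s i ≡ free) × (∀ y → s y ≡ free → Answers rs y (s [ y ]≔ breaker))

    Answers : List (Fin n × Fin n × Certificate) → Fin n → State n → Set
    Answers [] y s = ⊥
    Answers ((y′ , x , c) ∷ rs) y s with y ≟ᶠ y′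
    ... | yes _ = s x ≡ free × Certifies c (s [ x ]≔ maker)
    ... | no _ = Answers rs y s

  mutual
    Certifies⇒Secured : ∀ c {s} → Certifies c s → Secured s
    Certifies⇒Secured (pairing R ps) (v , resp) = paired v resp
    Certifies⇒Secured (respond rs) (some-free , answers) =
      branch some-free λ {y} sy≡free → Answers⇒Securable rs y (answers y sy≡free)

    Answers⇒Securable : ∀ rs y {s} → Answers rs y s → Securable s
    Answers⇒Securable ((y′ , x , c) ∷ rs) y answer with y ≟ᶠ y′
    ... | yes _ = claim (proj₁ answer) (Certifies⇒Secured c (proj₂ answer))
    ... | no _ = Answers⇒Securable rs y answer

  symmetric? : ∀ ps → Dec (Symmetric ps)
  symmetric? ps = all? λ i → Maybe.dec (λ j → ¬? (j ≟ᶠ i) ×-dec ≡-decᵐ _≟ᶠ_ (partner ps j) (just i)) (partner ps i)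

  listed? : ∀ ps → Dec (Listed ps)
  listed? ps = All.all? (λ (a , b) → ≡-decᵐ _≟ᶠ_ (partner ps a) (just b)) ps

  everyChoiceWins? : ∀ R ps → Dec (EveryChoiceWins R ps)
  everyChoiceWins? R [] = won? (makerOn R)
  everyChoiceWins? R ((a , b) ∷ ps) = everyChoiceWins? (a ∷ R) ps ×-dec everyChoiceWins? (b ∷ R) ps

  validPairing? : ∀ R ps → Dec (ValidPairing R ps)
  validPairing? R ps = map′ (λ (s , l , w) → valid s l w) (λ (valid s l w) → s , l , w)
    (symmetric? ps ×-dec listed? ps ×-dec everyChoiceWins? R ps)

  respects? : ∀ R ps s → Dec (Respects R ps s)
  respects? R ps s = map′ (λ (c , i) → respects (c _) i) (λ (respects c i) → (λ _ → c) , i)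
    (all? (λ i → (i ∈? R) →-dec (s i ≟ᶜ maker)) ×-dec all? (λ i → Maybe.dec (λ j → intact? (s i) (s j)) (partner ps i)))

  mutual
    certifies? : ∀ c s → Dec (Certifies c s)
    certifies? (pairing R ps) s = validPairing? R ps ×-dec respects? R ps s
    certifies? (respond rs) s =
      any? (λ i → s i ≟ᶜ free) ×-dec all? (λ y → (s y ≟ᶜ free) →-dec answers? rs y (s [ y ]≔ breaker))

    answers? : ∀ rs y s → Dec (Answers rs y s)
    answers? [] y s = no λ ()
    answers? ((y′ , x , c) ∷ rs) y s with y ≟ᶠ y′
    ... | yes _ = (s x ≟ᶜ free) ×-dec certifies? c (s [ x ]≔ maker)
    ... | no _ = answers? rs y s

-- Remainder and quotient of r + q d are unique because |(q - q′) d| = |r′ - r| < d.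
+r+q*d-injective : ∀ {d r r′} q q′ → r < d → r′ < d →
  + r ℤ.+ q ℤ.* + d ≡ + r′ ℤ.+ q′ ℤ.* + d → r ≡ r′ × q ≡ q′
+r+q*d-injective {d} {r} {r′} q q′ r<d r′<d eq = sym r′≡r , q≡q′
  where
  rearrange : ∀ R R′ Q Q′ D →
    (Q ℤ.- Q′) ℤ.* D ≡ (R′ ℤ.- R) ℤ.+ ((R ℤ.+ Q ℤ.* D) ℤ.- (R′ ℤ.+ Q′ ℤ.* D))
  rearrange = ℤ-Solver.solve-∀
  diff : (q ℤ.- q′) ℤ.* + d ≡ r′ ⊖ r
  diff = begin
    (q ℤ.- q′) ℤ.* + d                                 ≡⟨ rearrange (+ r) (+ r′) q q′ (+ d) ⟩
    (+ r′ ℤ.- + r) ℤ.+ (X ℤ.- Y)                       ≡⟨ cong (λ z → (+ r′ ℤ.- + r) ℤ.+ (z ℤ.- Y)) eq ⟩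
    (+ r′ ℤ.- + r) ℤ.+ (Y ℤ.- Y)                       ≡⟨ cong (λ z → (+ r′ ℤ.- + r) ℤ.+ z) (ℤ.+-inverseʳ Y) ⟩
    (+ r′ ℤ.- + r) ℤ.+ + 0                             ≡⟨ ℤ.+-identityʳ _ ⟩
    + r′ ℤ.- + r                                       ≡⟨ ℤ.[+m]-[+n]≡m⊖n r′ r ⟩
    r′ ⊖ r                                             ∎
    where
    open ≡-Reasoning
    X Y : ℤ
    X = + r ℤ.+ q ℤ.* + d
    Y = + r′ ℤ.+ q′ ℤ.* + d
  abs-diff : ∣ q ℤ.- q′ ∣ * d ≡ ∣ r′ ⊖ r ∣
  abs-diff = trans (sym (ℤ.abs-* (q ℤ.- q′) (+ d))) (cong ∣_∣ diff)
  ∣q-q′∣≡0 : ∣ q ℤ.- q′ ∣ ≡ 0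
  ∣q-q′∣≡0 = n<1⇒n≡0 (*-cancelʳ-< d _ 1 (subst₂ _<_ (sym abs-diff) (sym (*-identityˡ d)) ∣r′-r∣<d))
    where
    ∣r′-r∣<d : ∣ r′ ⊖ r ∣ < d
    ∣r′-r∣<d = ≤-<-trans (ℤ.∣m⊝n∣≤m⊔n r′ r) (⊔-lub r′<d r<d)
  q≡q′ : q ≡ q′
  q≡q′ = ℤ.i-j≡0⇒i≡j q q′ (ℤ.∣i∣≡0⇒i≡0 ∣q-q′∣≡0)
  r′≡r : r′ ≡ r
  r′≡r = ℤ.+-injective (ℤ.i-j≡0⇒i≡j (+ r′) (+ r)
    (trans (ℤ.[+m]-[+n]≡m⊖n r′ r) (ℤ.∣i∣≡0⇒i≡0 (trans (sym abs-diff) (cong (_* d) ∣q-q′∣≡0)))))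

%ℕ-/ℕ-unique : ∀ d .{{_ : NonZero d}} {r} q → r < d →
  (+ r ℤ.+ q ℤ.* + d) %ℕ d ≡ r × (+ r ℤ.+ q ℤ.* + d) /ℕ d ≡ q
%ℕ-/ℕ-unique d {r} q r<d = +r+q*d-injective (n /ℕ d) q (n%ℕd<d n d) r<d (sym (a≡a%ℕn+[a/ℕn]*n n d))
  where
  n : ℤ
  n = + r ℤ.+ q ℤ.* + d

fromℕ<-[c+qd]%ℕd : ∀ d .{{_ : NonZero d}} (c : Fin d) q → fromℕ< (n%ℕd<d (+ toℕ c ℤ.+ q ℤ.* + d) d) ≡ c
fromℕ<-[c+qd]%ℕd d c q = toℕ-injective (trans (toℕ-fromℕ< _) (proj₁ (%ℕ-/ℕ-unique d q (toℕ<n c))))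

[k+z]+1≡1+k+z : ∀ k z → (k ℤ.+ z) ℤ.+ ℤ.1ℤ ≡ (ℤ.1ℤ ℤ.+ k) ℤ.+ z
[k+z]+1≡1+k+z = ℤ-Solver.solve-∀

corners-+ : ∀ a b X Y → corners (+ a ℤ.+ X , + b ℤ.+ Y) ≡
  (+ a ℤ.+ X , + b ℤ.+ Y) ∷ (+ suc a ℤ.+ X , + b ℤ.+ Y) ∷
  (+ a ℤ.+ X , + suc b ℤ.+ Y) ∷ (+ suc a ℤ.+ X , + suc b ℤ.+ Y) ∷ []
corners-+ a b X Y rewrite [k+z]+1≡1+k+z (+ a) X | [k+z]+1≡1+k+z (+ b) Y = refl

offset-∈ : ∀ {d k} → k < 2 * d + 2 → + k ℤ.- + d ∈ offsets d
offset-∈ {d} k< = ∈-map⁺ (λ i → + i ℤ.- + d) (∈-upTo⁺ k<)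

shift-∈-box : ∀ {d x y a b} → a ∈ offsets d → b ∈ offsets d → (x ℤ.+ a , y ℤ.+ b) ∈ box d (x , y)
shift-∈-box {d} {x} {y} {a} a∈ b∈ =
  ∈-concat⁺′ (∈-map⁺ (λ b → (x ℤ.+ a , y ℤ.+ b)) b∈)
             (∈-map⁺ (λ a → map (λ b → (x ℤ.+ a , y ℤ.+ b)) (offsets d)) a∈)

block-offset : ∀ {W d} .{{_ : NonZero W}} → W ≤ suc d → ∀ x {c} → c < W →
  ∃ λ a → a ∈ offsets d × x ℤ.+ a ≡ + c ℤ.+ (x /ℕ W) ℤ.* + W
block-offset {W} {d} W≤1+d x {c} c<W = + k ℤ.- + d , offset-∈ {d} k<2d+2 , shift
  where
  m k : ℕ
  m = x %ℕ W
  k = c + d ∸ m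
  m≤c+d : m ≤ c + d
  m≤c+d = ≤-trans (≤-pred (≤-trans (n%ℕd<d x W) W≤1+d)) (m≤n+m d c)
  k<2d+2 : k < 2 * d + 2
  k<2d+2 = begin-strict
    c + d ∸ m  ≤⟨ m∸n≤m (c + d) m ⟩
    c + d      ≤⟨ +-monoˡ-≤ d (≤-pred (≤-trans c<W W≤1+d)) ⟩
    d + d      ≡⟨ cong (λ z → d + z) (sym (+-identityʳ d)) ⟩
    2 * d      <⟨ m<m+n (2 * d) (s≤s z≤n) ⟩
    2 * d + 2  ∎
    where open ≤-Reasoning
  rearrange : ∀ M C D Z → (M ℤ.+ Z) ℤ.+ ((C ℤ.+ D ℤ.- M) ℤ.- D) ≡ C ℤ.+ Z
  rearrange = ℤ-Solver.solve-∀
  +k≡ : + k ≡ + c ℤ.+ + d ℤ.- + m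
  +k≡ = trans (sym (ℤ.⊖-≥ m≤c+d)) (trans (sym (ℤ.[+m]-[+n]≡m⊖n (c + d) m)) (cong (ℤ._- + m) (ℤ.pos-+ c d)))
  shift : x ℤ.+ (+ k ℤ.- + d) ≡ + c ℤ.+ (x /ℕ W) ℤ.* + W
  shift = trans (cong₂ (λ x′ k′ → x′ ℤ.+ (k′ ℤ.- + d)) (a≡a%ℕn+[a/ℕn]*n x W) +k≡)
                (rearrange (+ m) (+ c) (+ d) ((x /ℕ W) ℤ.* + W))

-- Tiles are the (1 + w) × (1 + h) blocks of lattice points; slot combine r c of a tile is its point in row r,
-- column c, and its local squares are the w × h unit squares with all four corners in the tile.
module Tiling (w h : ℕ) where

  Slot : Set
  Slot = Fin (suc h * suc w)

  Tile : Set
  Tile = ℤ × ℤ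

  point : Tile → Slot → Point
  point (tx , ty) i =
    (+ toℕ (remainder {suc h} (suc w) i) ℤ.+ tx ℤ.* + suc w , + toℕ (quotient {suc h} (suc w) i) ℤ.+ ty ℤ.* + suc h)

  tileOf : Point → Tile
  tileOf (x , y) = (x /ℕ suc w , y /ℕ suc h)

  slotOf : Point → Slot
  slotOf (x , y) = combine (fromℕ< (n%ℕd<d y (suc h))) (fromℕ< (n%ℕd<d x (suc w)))

  point-combine : ∀ tx ty (r : Fin (suc h)) (c : Fin (suc w)) →
    point (tx , ty) (combine r c) ≡ (+ toℕ c ℤ.+ tx ℤ.* + suc w , + toℕ r ℤ.+ ty ℤ.* + suc h)
  point-combine tx ty r c =
    cong (λ (a , b) → (+ toℕ b ℤ.+ tx ℤ.* + suc w , + toℕ a ℤ.+ ty ℤ.* + suc h)) (remQuot-combine r c)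

  point-tileOf-slotOf : ∀ p → point (tileOf p) (slotOf p) ≡ p
  point-tileOf-slotOf (x , y) = trans (point-combine (x /ℕ suc w) (y /ℕ suc h) _ _) (cong₂ _,_
    (trans (cong (λ a → + a ℤ.+ (x /ℕ suc w) ℤ.* + suc w) (toℕ-fromℕ< _)) (sym (a≡a%ℕn+[a/ℕn]*n x (suc w))))
    (trans (cong (λ b → + b ℤ.+ (y /ℕ suc h) ℤ.* + suc h) (toℕ-fromℕ< _)) (sym (a≡a%ℕn+[a/ℕn]*n y (suc h)))))

  tileOf-point : ∀ t i → tileOf (point t i) ≡ t
  tileOf-point (tx , ty) i = cong₂ _,_
    (proj₂ (%ℕ-/ℕ-unique (suc w) tx (toℕ<n (remainder {suc h} (suc w) i))))
    (proj₂ (%ℕ-/ℕ-unique (suc h) ty (toℕ<n (quotient {suc h} (suc w) i))))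

  slotOf-point : ∀ t i → slotOf (point t i) ≡ i
  slotOf-point (tx , ty) i = trans
    (cong₂ combine (fromℕ<-[c+qd]%ℕd (suc h) (quotient {suc h} (suc w) i) ty) (fromℕ<-[c+qd]%ℕd (suc w) (remainder {suc h} (suc w) i) tx))
    (combine-remQuot {suc h} (suc w) i)

  point-injective : ∀ t {i j} → point t i ≡ point t j → i ≡ j
  point-injective t {i} {j} eq = trans (sym (slotOf-point t i)) (trans (cong slotOf eq) (slotOf-point t j))

  LocalSquare : Set
  LocalSquare = Fin (h * w)

  lowerLeft : LocalSquare → Slot
  lowerLeft q = combine (inject₁ (quotient {h} w q)) (inject₁ (remainder {h} w q))

  squareSlots : LocalSquare → List Slot
  squareSlots q =
    combine (inject₁ r) (inject₁ c) ∷ combine (inject₁ r) (suc c) ∷ combine (suc r) (inject₁ c) ∷ combine (suc r) (suc c) ∷ []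
    where
    r : Fin h
    r = quotient {h} w q
    c : Fin w
    c = remainder {h} w q

  lowerLeft-injective : ∀ {q q′} → lowerLeft q ≡ lowerLeft q′ → q ≡ q′
  lowerLeft-injective {q} {q′} eq
    with combine-injective (inject₁ (quotient {h} w q)) (inject₁ (remainder {h} w q))
                           (inject₁ (quotient {h} w q′)) (inject₁ (remainder {h} w q′)) eq
  ... | r≡r′ , c≡c′ = trans (sym (combine-remQuot {h} w q))
        (trans (cong₂ combine (inject₁-injective r≡r′) (inject₁-injective c≡c′)) (combine-remQuot {h} w q′))

  corners-point-lowerLeft : ∀ t q → corners (point t (lowerLeft q)) ≡ map (point t) (squareSlots q)
  corners-point-lowerLeft (tx , ty) q = begin
    corners (point (tx , ty) (lowerLeft q))          ≡⟨ cong corners (P-combine (inject₁ r) (inject₁ c)) ⟩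
    corners (P (toℕ (inject₁ c)) (toℕ (inject₁ r)))  ≡⟨ cong₂ (λ a b → corners (P a b)) (toℕ-inject₁ c) (toℕ-inject₁ r) ⟩
    corners (P (toℕ c) (toℕ r))                      ≡⟨ corners-+ (toℕ c) (toℕ r) X Y ⟩
    P (toℕ c) (toℕ r) ∷ P (suc (toℕ c)) (toℕ r) ∷ P (toℕ c) (suc (toℕ r)) ∷ P (suc (toℕ c)) (suc (toℕ r)) ∷ []
      ≡⟨ cong₂ (λ a b → P a b ∷ P (suc (toℕ c)) b ∷ P a (suc (toℕ r)) ∷ P (suc (toℕ c)) (suc (toℕ r)) ∷ [])
               (sym (toℕ-inject₁ c)) (sym (toℕ-inject₁ r)) ⟩
    P (toℕ (inject₁ c)) (toℕ (inject₁ r)) ∷ P (suc (toℕ c)) (toℕ (inject₁ r)) ∷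
    P (toℕ (inject₁ c)) (suc (toℕ r)) ∷ P (suc (toℕ c)) (suc (toℕ r)) ∷ []
      ≡⟨ sym (cong₂ _∷_ (P-combine _ _) (cong₂ _∷_ (P-combine _ _)
               (cong₂ _∷_ (P-combine _ _) (cong (_∷ []) (P-combine _ _))))) ⟩
    map (point (tx , ty)) (squareSlots q)            ∎
    where
    open ≡-Reasoning
    r : Fin h
    r = quotient {h} w q
    c : Fin w
    c = remainder {h} w q
    X Y : ℤ
    X = tx ℤ.* + suc w
    Y = ty ℤ.* + suc h
    P : ℕ → ℕ → Point
    P a b = (+ a ℤ.+ X , + b ℤ.+ Y)
    P-combine : ∀ r′ c′ → point (tx , ty) (combine r′ c′) ≡ P (toℕ c′) (toℕ r′)
    P-combine = point-combine tx ty

  point-tileOf∈box : ∀ {d} → w ≤ d → h ≤ d → ∀ p i → point (tileOf p) i ∈ box d p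
  point-tileOf∈box {d} w≤d h≤d (x , y) i
    with block-offset (s≤s w≤d) x (toℕ<n (remainder {suc h} (suc w) i))
       | block-offset (s≤s h≤d) y (toℕ<n (quotient {suc h} (suc w) i))
  ... | a , a∈ , x+a≡ | b , b∈ , y+b≡ =
    subst (_∈ box d (x , y)) (cong₂ _,_ x+a≡ y+b≡) (shift-∈-box {d} {x} {y} a∈ b∈)

open Tiling 4 2

makerCount : State 15 → LocalSquare → ℕ
makerCount s q = length (filter (λ i → s i ≟ᶜ maker) (squareSlots q))

TileWon : State 15 → Set
TileWon s = ∃₂ λ q q′ → q ≢ q′ × 3 ≤ makerCount s q × 3 ≤ makerCount s q′

makerCount-mono : ∀ {s s′} → s ⊆ᵐ s′ → ∀ q → makerCount s q ≤ makerCount s′ q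
makerCount-mono {s} {s′} s⊆s′ q = Sublist.length-mono-≤
  (Sublist.filter⁺ (λ i → s i ≟ᶜ maker) (λ i → s′ i ≟ᶜ maker) (λ { refl → s⊆s′ }) (⊆-refl {x = squareSlots q}))

TileWon-mono : ∀ {s s′} → s ⊆ᵐ s′ → TileWon s → TileWon s′
TileWon-mono s⊆s′ (q , q′ , q≢q′ , three , three′) =
  q , q′ , q≢q′ , ≤-trans three (makerCount-mono s⊆s′ q) , ≤-trans three′ (makerCount-mono s⊆s′ q′)

tileWon? : ∀ s → Dec (TileWon s)
tileWon? s = any? λ q → any? λ q′ → ¬? (q ≟ᶠ q′) ×-dec (3 ≤? makerCount s q) ×-dec (3 ≤? makerCount s q′)

open LocalGame TileWon TileWon-mono tileWon?

-- Slot i of a tile is its point in column i mod 5 and row i div 5.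
tileStrategy : Certificate
tileStrategy = respond (
  (# 0 , # 6 , pairing (# 6 ∷ []) ((# 2 , # 13) ∷ (# 3 , # 9) ∷ (# 4 , # 14) ∷ (# 5 , # 10) ∷ (# 7 , # 11) ∷ (# 8 , # 12) ∷ [])) ∷
  (# 1 , # 6 , pairing (# 6 ∷ []) ((# 2 , # 13) ∷ (# 3 , # 9) ∷ (# 4 , # 14) ∷ (# 5 , # 10) ∷ (# 7 , # 11) ∷ (# 8 , # 12) ∷ [])) ∷
  (# 2 , # 6 , pairing (# 6 ∷ []) ((# 0 , # 1) ∷ (# 4 , # 14) ∷ (# 5 , # 11) ∷ (# 7 , # 12) ∷ (# 8 , # 10) ∷ (# 9 , # 13) ∷ [])) ∷
  (# 3 , # 6 , pairing (# 6 ∷ []) ((# 0 , # 1) ∷ (# 4 , # 14) ∷ (# 5 , # 11) ∷ (# 7 , # 12) ∷ (# 8 , # 10) ∷ (# 9 , # 13) ∷ [])) ∷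
  (# 4 , # 6 , pairing (# 6 ∷ []) ((# 1 , # 3) ∷ (# 2 , # 13) ∷ (# 5 , # 10) ∷ (# 7 , # 11) ∷ (# 8 , # 12) ∷ (# 9 , # 14) ∷ [])) ∷
  (# 5 , # 7 , pairing (# 7 ∷ []) ((# 1 , # 4) ∷ (# 2 , # 9) ∷ (# 3 , # 13) ∷ (# 6 , # 8) ∷ (# 10 , # 14) ∷ (# 11 , # 12) ∷ [])) ∷
  (# 6 , # 8 , pairing (# 8 ∷ []) ((# 1 , # 5) ∷ (# 2 , # 14) ∷ (# 3 , # 7) ∷ (# 4 , # 12) ∷ (# 9 , # 13) ∷ (# 10 , # 11) ∷ [])) ∷
  (# 7 , # 6 , respond (
    (# 0 , # 1 , pairing (# 1 ∷ # 6 ∷ []) ((# 2 , # 5) ∷ (# 3 , # 9) ∷ (# 4 , # 13) ∷ (# 8 , # 11) ∷ (# 10 , # 12) ∷ [])) ∷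
    (# 1 , # 5 , pairing (# 5 ∷ # 6 ∷ []) ((# 0 , # 8) ∷ (# 3 , # 4) ∷ (# 9 , # 13) ∷ (# 10 , # 11) ∷ (# 12 , # 14) ∷ [])) ∷
    (# 2 , # 5 , pairing (# 5 ∷ # 6 ∷ []) ((# 1 , # 8) ∷ (# 3 , # 4) ∷ (# 9 , # 13) ∷ (# 10 , # 11) ∷ (# 12 , # 14) ∷ [])) ∷
    (# 3 , # 1 , pairing (# 1 ∷ # 6 ∷ []) ((# 0 , # 5) ∷ (# 2 , # 8) ∷ (# 9 , # 10) ∷ (# 11 , # 13) ∷ (# 12 , # 14) ∷ [])) ∷
    (# 4 , # 0 , pairing (# 0 ∷ # 6 ∷ []) ((# 1 , # 5) ∷ (# 2 , # 9) ∷ (# 3 , # 13) ∷ (# 8 , # 11) ∷ (# 10 , # 12) ∷ [])) ∷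
    (# 5 , # 1 , respond (
      (# 0 , # 2 , pairing (# 1 ∷ # 2 ∷ # 6 ∷ []) ((# 3 , # 9) ∷ (# 8 , # 11) ∷ (# 10 , # 12) ∷ (# 13 , # 14) ∷ [])) ∷
      (# 2 , # 8 , respond (
        (# 0 , # 9 , pairing (# 1 ∷ # 6 ∷ # 8 ∷ # 9 ∷ []) ((# 4 , # 11) ∷ (# 10 , # 12) ∷ (# 13 , # 14) ∷ [])) ∷
        (# 3 , # 0 , pairing (# 0 ∷ # 1 ∷ # 6 ∷ # 8 ∷ []) ((# 9 , # 10) ∷ (# 11 , # 13) ∷ (# 12 , # 14) ∷ [])) ∷
        (# 4 , # 0 , pairing (# 0 ∷ # 1 ∷ # 6 ∷ # 8 ∷ []) ((# 9 , # 10) ∷ (# 11 , # 13) ∷ (# 12 , # 14) ∷ [])) ∷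
        (# 9 , # 12 , respond (
          (# 0 , # 11 , pairing (# 1 ∷ # 6 ∷ # 8 ∷ # 11 ∷ # 12 ∷ []) ((# 4 , # 14) ∷ (# 10 , # 13) ∷ [])) ∷
          (# 3 , # 0 , pairing (# 0 ∷ # 1 ∷ # 6 ∷ # 8 ∷ # 12 ∷ []) ((# 10 , # 14) ∷ (# 11 , # 13) ∷ [])) ∷
          (# 4 , # 0 , pairing (# 0 ∷ # 1 ∷ # 6 ∷ # 8 ∷ # 12 ∷ []) ((# 10 , # 14) ∷ (# 11 , # 13) ∷ [])) ∷
          (# 10 , # 0 , pairing (# 0 ∷ # 1 ∷ # 6 ∷ # 8 ∷ # 12 ∷ []) ((# 4 , # 14) ∷ (# 11 , # 13) ∷ [])) ∷
          (# 11 , # 13 , pairing (# 1 ∷ # 6 ∷ # 8 ∷ # 12 ∷ # 13 ∷ []) ((# 0 , # 3) ∷ (# 4 , # 14) ∷ [])) ∷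
          (# 13 , # 11 , pairing (# 1 ∷ # 6 ∷ # 8 ∷ # 11 ∷ # 12 ∷ []) ((# 0 , # 3) ∷ (# 4 , # 10) ∷ [])) ∷
          (# 14 , # 0 , pairing (# 0 ∷ # 1 ∷ # 6 ∷ # 8 ∷ # 12 ∷ []) ((# 4 , # 10) ∷ (# 11 , # 13) ∷ [])) ∷ [])) ∷
        (# 10 , # 0 , pairing (# 0 ∷ # 1 ∷ # 6 ∷ # 8 ∷ []) ((# 4 , # 11) ∷ (# 9 , # 13) ∷ (# 12 , # 14) ∷ [])) ∷
        (# 11 , # 0 , pairing (# 0 ∷ # 1 ∷ # 6 ∷ # 8 ∷ []) ((# 3 , # 4) ∷ (# 9 , # 13) ∷ (# 12 , # 14) ∷ [])) ∷
        (# 12 , # 9 , pairing (# 1 ∷ # 6 ∷ # 8 ∷ # 9 ∷ []) ((# 3 , # 4) ∷ (# 10 , # 11) ∷ (# 13 , # 14) ∷ [])) ∷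
        (# 13 , # 0 , pairing (# 0 ∷ # 1 ∷ # 6 ∷ # 8 ∷ []) ((# 4 , # 14) ∷ (# 9 , # 11) ∷ (# 10 , # 12) ∷ [])) ∷
        (# 14 , # 0 , pairing (# 0 ∷ # 1 ∷ # 6 ∷ # 8 ∷ []) ((# 4 , # 10) ∷ (# 9 , # 12) ∷ (# 11 , # 13) ∷ [])) ∷ [])) ∷
      (# 3 , # 0 , pairing (# 0 ∷ # 1 ∷ # 6 ∷ []) ((# 2 , # 8) ∷ (# 9 , # 10) ∷ (# 11 , # 13) ∷ (# 12 , # 14) ∷ [])) ∷
      (# 4 , # 0 , pairing (# 0 ∷ # 1 ∷ # 6 ∷ []) ((# 2 , # 8) ∷ (# 9 , # 10) ∷ (# 11 , # 13) ∷ (# 12 , # 14) ∷ [])) ∷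
      (# 8 , # 0 , pairing (# 0 ∷ # 1 ∷ # 6 ∷ []) ((# 2 , # 11) ∷ (# 4 , # 9) ∷ (# 10 , # 12) ∷ (# 13 , # 14) ∷ [])) ∷
      (# 9 , # 0 , pairing (# 0 ∷ # 1 ∷ # 6 ∷ []) ((# 2 , # 11) ∷ (# 4 , # 8) ∷ (# 10 , # 12) ∷ (# 13 , # 14) ∷ [])) ∷
      (# 10 , # 0 , pairing (# 0 ∷ # 1 ∷ # 6 ∷ []) ((# 2 , # 8) ∷ (# 4 , # 11) ∷ (# 9 , # 13) ∷ (# 12 , # 14) ∷ [])) ∷
      (# 11 , # 0 , pairing (# 0 ∷ # 1 ∷ # 6 ∷ []) ((# 2 , # 8) ∷ (# 3 , # 4) ∷ (# 9 , # 13) ∷ (# 12 , # 14) ∷ [])) ∷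
      (# 12 , # 2 , pairing (# 1 ∷ # 2 ∷ # 6 ∷ []) ((# 0 , # 8) ∷ (# 3 , # 9) ∷ (# 10 , # 11) ∷ (# 13 , # 14) ∷ [])) ∷
      (# 13 , # 0 , pairing (# 0 ∷ # 1 ∷ # 6 ∷ []) ((# 2 , # 3) ∷ (# 4 , # 8) ∷ (# 9 , # 11) ∷ (# 10 , # 12) ∷ [])) ∷
      (# 14 , # 0 , pairing (# 0 ∷ # 1 ∷ # 6 ∷ []) ((# 2 , # 3) ∷ (# 4 , # 8) ∷ (# 9 , # 11) ∷ (# 10 , # 12) ∷ [])) ∷ [])) ∷
    (# 8 , # 1 , pairing (# 1 ∷ # 6 ∷ []) ((# 0 , # 5) ∷ (# 2 , # 11) ∷ (# 4 , # 9) ∷ (# 10 , # 12) ∷ (# 13 , # 14) ∷ [])) ∷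
    (# 9 , # 1 , pairing (# 1 ∷ # 6 ∷ []) ((# 0 , # 5) ∷ (# 2 , # 11) ∷ (# 4 , # 8) ∷ (# 10 , # 12) ∷ (# 13 , # 14) ∷ [])) ∷
    (# 10 , # 0 , pairing (# 0 ∷ # 6 ∷ []) ((# 1 , # 5) ∷ (# 2 , # 12) ∷ (# 3 , # 9) ∷ (# 4 , # 13) ∷ (# 8 , # 11) ∷ [])) ∷
    (# 11 , # 1 , pairing (# 1 ∷ # 6 ∷ []) ((# 0 , # 5) ∷ (# 2 , # 8) ∷ (# 3 , # 4) ∷ (# 9 , # 13) ∷ (# 12 , # 14) ∷ [])) ∷
    (# 12 , # 1 , pairing (# 1 ∷ # 6 ∷ []) ((# 0 , # 3) ∷ (# 2 , # 9) ∷ (# 5 , # 8) ∷ (# 10 , # 11) ∷ (# 13 , # 14) ∷ [])) ∷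
    (# 13 , # 1 , pairing (# 1 ∷ # 6 ∷ []) ((# 0 , # 3) ∷ (# 2 , # 10) ∷ (# 4 , # 8) ∷ (# 5 , # 11) ∷ (# 9 , # 12) ∷ [])) ∷
    (# 14 , # 0 , pairing (# 0 ∷ # 6 ∷ []) ((# 1 , # 5) ∷ (# 2 , # 9) ∷ (# 3 , # 13) ∷ (# 8 , # 11) ∷ (# 10 , # 12) ∷ [])) ∷ [])) ∷
  (# 8 , # 6 , pairing (# 6 ∷ []) ((# 0 , # 12) ∷ (# 1 , # 5) ∷ (# 2 , # 10) ∷ (# 4 , # 9) ∷ (# 7 , # 11) ∷ (# 13 , # 14) ∷ [])) ∷
  (# 9 , # 6 , pairing (# 6 ∷ []) ((# 0 , # 1) ∷ (# 2 , # 4) ∷ (# 3 , # 13) ∷ (# 5 , # 11) ∷ (# 7 , # 12) ∷ (# 8 , # 10) ∷ [])) ∷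
  (# 10 , # 6 , pairing (# 6 ∷ []) ((# 1 , # 11) ∷ (# 2 , # 5) ∷ (# 3 , # 12) ∷ (# 4 , # 14) ∷ (# 7 , # 8) ∷ (# 9 , # 13) ∷ [])) ∷
  (# 11 , # 6 , pairing (# 6 ∷ []) ((# 0 , # 5) ∷ (# 1 , # 7) ∷ (# 2 , # 8) ∷ (# 3 , # 12) ∷ (# 4 , # 14) ∷ (# 9 , # 13) ∷ [])) ∷
  (# 12 , # 6 , pairing (# 6 ∷ []) ((# 0 , # 8) ∷ (# 1 , # 5) ∷ (# 2 , # 7) ∷ (# 3 , # 9) ∷ (# 10 , # 11) ∷ (# 13 , # 14) ∷ [])) ∷
  (# 13 , # 6 , pairing (# 6 ∷ []) ((# 0 , # 1) ∷ (# 2 , # 8) ∷ (# 3 , # 12) ∷ (# 4 , # 9) ∷ (# 5 , # 7) ∷ (# 10 , # 11) ∷ [])) ∷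
  (# 14 , # 6 , pairing (# 6 ∷ []) ((# 1 , # 3) ∷ (# 2 , # 9) ∷ (# 4 , # 13) ∷ (# 5 , # 10) ∷ (# 7 , # 11) ∷ (# 8 , # 12) ∷ [])) ∷ [])

Secured-emptyTile : Secured (λ _ → free)
Secured-emptyTile = Certifies⇒Secured tileStrategy (from-yes (certifies? tileStrategy (λ _ → free)))

open GameValue _≟P_
open DecMembership _≟P_ using (_∈?_)

_≟T_ : DecidableEquality Tile
_≟T_ = ≡-dec ℤ._≟_ ℤ._≟_

cellOf : List Point → List Point → Point → Cell
cellOf M U p = if does (p ∈? M) then maker else if does (p ∈? U) then free else breaker

cellOf-cong : ∀ {M U M′ U′ p} → (p ∈ M ⇔ p ∈ M′) → (p ∈ U ⇔ p ∈ U′) → cellOf M U p ≡ cellOf M′ U′ p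
cellOf-cong {M} {U} {M′} {U′} {p} M⇔M′ U⇔U′ =
  cong₂ (λ m u → if m then maker else if u then free else breaker)
        (does-⇔ M⇔M′ (p ∈? M) (p ∈? M′)) (does-⇔ U⇔U′ (p ∈? U) (p ∈? U′))

cellOf-maker : ∀ M U {p} → p ∈ M → cellOf M U p ≡ maker
cellOf-maker M U {p} p∈M rewrite dec-true (p ∈? M) p∈M = refl

cellOf-free : ∀ {M U p} → p ∉ M → p ∈ U → cellOf M U p ≡ free
cellOf-free {M} {U} {p} p∉M p∈U rewrite dec-false (p ∈? M) p∉M | dec-true (p ∈? U) p∈U = refl

cellOf-breaker : ∀ {M U p} → p ∉ M → p ∉ U → cellOf M U p ≡ breaker
cellOf-breaker {M} {U} {p} p∉M p∉U rewrite dec-false (p ∈? M) p∉M | dec-false (p ∈? U) p∉U = refl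

cellOf-free⁻ : ∀ {M U p} → cellOf M U p ≡ free → p ∈ U
cellOf-free⁻ {M} {U} {p} eq with p ∈? M | p ∈? U
... | yes _ | _ = contradiction eq λ ()
... | no _ | yes p∈U = p∈U
... | no _ | no _ = contradiction eq λ ()

cellOf-maker⁻ : ∀ {M U p} → cellOf M U p ≡ maker → p ∈ M
cellOf-maker⁻ {M} {U} {p} eq with p ∈? M | p ∈? U
... | yes p∈M | _ = p∈M
... | no _ | yes _ = contradiction eq λ ()
... | no _ | no _ = contradiction eq λ ()

cellOf-[] : ∀ M p → cellOf M [] p ≢ free
cellOf-[] M p eq = contradiction (cellOf-free⁻ {M} {[]} eq) λ ()

cellOf-maker-move : ∀ M {U x r p} → (x , r) ∈ picks U → p ≢ x → cellOf (x ∷ M) r p ≡ cellOf M U p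
cellOf-maker-move M {x = x} {p = p} xr∈ p≢x = cellOf-cong (mk⇔ drop-x there) (∈-picks⇔ xr∈ p≢x)
  where
  drop-x : p ∈ x ∷ M → p ∈ M
  drop-x (here p≡x) = contradiction p≡x p≢x
  drop-x (there p∈M) = p∈M

cellOf-breaker-move : ∀ M {U y r p} → (y , r) ∈ picks U → p ≢ y → cellOf M r p ≡ cellOf M U p
cellOf-breaker-move M yr∈ p≢y = cellOf-cong {M} {M′ = M} (mk⇔ id id) (∈-picks⇔ yr∈ p≢y)

cellOf-breaker-vertex : ∀ M {U y r} → (y , r) ∈ picks U →
  cellOf M r y ≡ cellOf M U y ⊎ (cellOf M U y ≡ free × cellOf M r y ≡ breaker)
cellOf-breaker-vertex M {U} {y} {r} yr∈ = cases (y ∈? M) (y ∈? r)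
  where
  y∈U : y ∈ U
  y∈U = picked∈ yr∈
  cases : Dec (y ∈ M) → Dec (y ∈ r) → cellOf M r y ≡ cellOf M U y ⊎ (cellOf M U y ≡ free × cellOf M r y ≡ breaker)
  cases (yes y∈M) _ = inj₁ (trans (cellOf-maker M r y∈M) (sym (cellOf-maker M U y∈M)))
  cases (no y∉M) (yes y∈r) = inj₁ (trans (cellOf-free y∉M y∈r) (sym (cellOf-free y∉M y∈U)))
  cases (no y∉M) (no y∉r) = inj₂ (cellOf-free y∉M y∈U , cellOf-breaker y∉M y∉r)

localState : List Point → List Point → Tile → State 15
localState M U t i = cellOf M U (point t i)

point≢-outside : ∀ {t p} → tileOf p ≢ t → ∀ i → point t i ≢ p
point≢-outside {t} tileₚ≢t i pᵢ≡p = tileₚ≢t (trans (cong tileOf (sym pᵢ≡p)) (tileOf-point t i))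

point≢-slot : ∀ p {i} → i ≢ slotOf p → point (tileOf p) i ≢ p
point≢-slot p {i} i≢slot pᵢ≡p = i≢slot (trans (sym (slotOf-point (tileOf p) i)) (cong slotOf pᵢ≡p))

localState-maker-move : ∀ {M U x r} → (x , r) ∈ picks U → ∀ t → localState M U t ⊑ localState (x ∷ M) r t
localState-maker-move {M} {U} {x} {r} xr∈ t i = cell (point t i ≟P x)
  where
  cell : Dec (point t i ≡ x) → cellOf M U (point t i) ≼ cellOf (x ∷ M) r (point t i)
  cell (yes refl) = subst (_ ≼_) (sym (cellOf-maker (x ∷ M) r (here refl))) ≼-maker
  cell (no pᵢ≢x) = ≡⇒≼ (sym (cellOf-maker-move M xr∈ pᵢ≢x))

localState-breaker-outside : ∀ {M U y r t} → (y , r) ∈ picks U → tileOf y ≢ t → localState M U t ⊑ localState M r t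
localState-breaker-outside {M} yr∈ tile≢t = ≗⇒⊑ λ i → sym (cellOf-breaker-move M yr∈ (point≢-outside tile≢t i))

localState-breaker-elsewhere : ∀ {M U y r i} → (y , r) ∈ picks U → i ≢ slotOf y →
  localState M U (tileOf y) i ≡ localState M r (tileOf y) i
localState-breaker-elsewhere {M} {y = y} yr∈ i≢slot = sym (cellOf-breaker-move M yr∈ (point≢-slot y i≢slot))

localState-breaker-unchanged : ∀ {M U y r} → (y , r) ∈ picks U → cellOf M r y ≡ cellOf M U y →
  localState M U (tileOf y) ⊑ localState M r (tileOf y)
localState-breaker-unchanged {M} {U} {y} {r} yr∈ unchanged = ≗⇒⊑ same
  where
  same : localState M U (tileOf y) ≗ localState M r (tileOf y)
  same i with point (tileOf y) i ≟P y
  ... | yes pᵢ≡y = subst (λ p → cellOf M U p ≡ cellOf M r p) (sym pᵢ≡y) (sym unchanged)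
  ... | no pᵢ≢y = sym (cellOf-breaker-move M yr∈ pᵢ≢y)

localState-breaker-claimed : ∀ {M U y r} → (y , r) ∈ picks U → cellOf M r y ≡ breaker →
  localState M U (tileOf y) [ slotOf y ]≔ breaker ⊑ localState M r (tileOf y)
localState-breaker-claimed {M} {U} {y} {r} yr∈ now-breaker =
  ⊑-[]≔ (λ i≢slot → ≡⇒≼ (localState-breaker-elsewhere {M} yr∈ i≢slot)) (≡⇒≼ (sym (at-slot now-breaker)))
  where
  at-slot : cellOf M r y ≡ breaker → cellOf M r (point (tileOf y) (slotOf y)) ≡ breaker
  at-slot = subst (λ p → cellOf M r p ≡ breaker) (sym (point-tileOf-slotOf y))

Securable-breaker-tile : ∀ {M U y r} → (y , r) ∈ picks U →
  Secured (localState M U (tileOf y)) → Securable (localState M r (tileOf y))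
Securable-breaker-tile {M} {U} {y} {r} yr∈ secured-before = by-cell (cellOf-breaker-vertex M yr∈)
  where
  by-cell : cellOf M r y ≡ cellOf M U y ⊎ (cellOf M U y ≡ free × cellOf M r y ≡ breaker) →
    Securable (localState M r (tileOf y))
  by-cell (inj₁ unchanged) = secured (Secured-mono (localState-breaker-unchanged {M} yr∈ unchanged) secured-before)
  by-cell (inj₂ (was-free , now-breaker)) =
    Securable-mono (localState-breaker-claimed {M} yr∈ now-breaker) (Secured-breaker {a = slotOf y} free-at-slot secured-before)
    where
    free-at-slot : cellOf M U (point (tileOf y) (slotOf y)) ≡ free
    free-at-slot = subst (λ p → cellOf M U p ≡ free) (sym (point-tileOf-slotOf y)) was-free

module _ (G : Grid) where

  Complete : Tile → Set
  Complete t = ∀ i → point t i ∈ pts G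

  complete? : ∀ t → Dec (Complete t)
  complete? t = all? λ i → point t i ∈? pts G

  AllTilesSecured : List Point → List Point → Set
  AllTilesSecured M U = ∀ t → Complete t → Secured (localState M U t)

  SecuredExcept : List Point → List Point → Tile → Set
  SecuredExcept M U t₀ = ∀ t → t ≢ t₀ → Complete t → Secured (localState M U t)

  OneTileOpen : List Point → List Point → Set
  OneTileOpen M U = ∃ λ t₀ → (Complete t₀ → Securable (localState M U t₀)) × SecuredExcept M U t₀

  AllTilesSecured-at : ∀ {M U t₀} → SecuredExcept M U t₀ → Secured (localState M U t₀) → AllTilesSecured M U
  AllTilesSecured-at {M} {U} {t₀} others secured₀ t complete = by-tile (t ≟T t₀)
    where
    by-tile : Dec (t ≡ t₀) → Secured (localState M U t)
    by-tile (yes refl) = secured₀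
    by-tile (no t≢t₀) = others t t≢t₀ complete

  AllTilesSecured-maker-move : ∀ {M U x r} → (x , r) ∈ picks U → AllTilesSecured M U → AllTilesSecured (x ∷ M) r
  AllTilesSecured-maker-move {M} {U} xr∈ all-secured t complete =
    Secured-mono (localState-maker-move {M} {U} xr∈ t) (all-secured t complete)

  breaker-move : ∀ {M U y r} → (y , r) ∈ picks U → AllTilesSecured M U → OneTileOpen M r
  breaker-move {M} {U} {y} yr∈ all-secured =
    tileOf y ,
    (λ complete → Securable-breaker-tile {M} {U} yr∈ (all-secured (tileOf y) complete)) ,
    (λ t t≢tile complete →
      Secured-mono (localState-breaker-outside {M} {U} yr∈ (λ tile≡t → t≢tile (sym tile≡t))) (all-secured t complete))

  claim-in-tile : ∀ {M U t₀} i → SecuredExcept M U t₀ →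
    Secured (localState M U t₀ [ i ]≔ maker) → ∀ {r} → (point t₀ i , r) ∈ picks U → AllTilesSecured (point t₀ i ∷ M) r
  claim-in-tile {M} {U} {t₀} i others secured₀ {r} xr∈ = AllTilesSecured-at {point t₀ i ∷ M} {r} {t₀}
    (λ t t≢t₀ complete → Secured-mono (localState-maker-move {M} {U} xr∈ t) (others t t≢t₀ complete))
    (Secured-mono (⊑-update-maker i maker (localState-maker-move {M} {U} xr∈ t₀) (cellOf-maker (point t₀ i ∷ M) r (here refl)))
      secured₀)

  maker-move : ∀ {M u us} → OneTileOpen M (u ∷ us) → ∃₂ λ x r → (x , r) ∈ picks (u ∷ us) × AllTilesSecured (x ∷ M) r
  maker-move {M} {u} {us} (t₀ , open₀ , others) = by-open (complete? t₀)
    where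
    spare : AllTilesSecured M (u ∷ us) → ∃₂ λ x r → (x , r) ∈ picks (u ∷ us) × AllTilesSecured (x ∷ M) r
    spare all-secured = u , us , here refl , AllTilesSecured-maker-move {M} {u ∷ us} (here refl) all-secured
    answer : Securable (localState M (u ∷ us) t₀) → ∃₂ λ x r → (x , r) ∈ picks (u ∷ us) × AllTilesSecured (x ∷ M) r
    answer (secured secured₀) = spare (AllTilesSecured-at {M} {u ∷ us} {t₀} others secured₀)
    answer (claim {i} free₀ secured₀) =
      let r , xr∈ = ∈⇒∈-picks (cellOf-free⁻ {M} {u ∷ us} free₀)
      in point t₀ i , r , xr∈ , claim-in-tile {M} {u ∷ us} {t₀} i others secured₀ xr∈
    by-open : Dec (Complete t₀) → ∃₂ λ x r → (x , r) ∈ picks (u ∷ us) × AllTilesSecured (x ∷ M) r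
    by-open (yes complete₀) = answer (open₀ complete₀)
    by-open (no incomplete₀) = spare λ t complete → others t (λ { refl → incomplete₀ complete }) complete

  interior : List Point
  interior = filter (λ p → All.all? (_∈? pts G) (box 4 p)) (squareCorners G)

  winningCorners : List Point → List Point
  winningCorners M = filter (λ p → 3 ≤? hits M (corners p)) (squareCorners G)

  nSq≡interior+nearBoundary : nSq G ≡ length interior + nearBoundary 4 G
  nSq≡interior+nearBoundary =
    trans (length-map corners (squareCorners G)) (length-filter+filter-¬ (λ p → All.all? (_∈? pts G) (box 4 p)) (squareCorners G))

  finalScore≡winningCorners : ∀ M → finalScore (squares G) 3 M ≡ length (winningCorners M)
  finalScore≡winningCorners M = length-filter-map corners (λ F → 3 ≤? hits M F) (squareCorners G)

  interior-complete : ∀ {p} → p ∈ interior → Complete (tileOf p)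
  interior-complete {p} p∈ i =
    All.lookup (proj₂ (∈-filter⁻ (λ p → All.all? (_∈? pts G) (box 4 p)) {xs = squareCorners G} p∈))
      (point-tileOf∈box (s≤s (s≤s (s≤s (s≤s z≤n)))) (s≤s (s≤s z≤n)) p i)

  makerCount≡hits : ∀ M U t q → makerCount (localState M U t) q ≡ hits M (corners (point t (lowerLeft q)))
  makerCount≡hits M U t q = begin
    length (filter (λ i → localState M U t i ≟ᶜ maker) (squareSlots q))
      ≡⟨ cong length (filter-≐ (λ i → localState M U t i ≟ᶜ maker) (λ i → point t i ∈? M)
                                (cellOf-maker⁻ {M} {U} , cellOf-maker M U) (squareSlots q)) ⟩
    length (filter (λ i → point t i ∈? M) (squareSlots q))
      ≡⟨ sym (length-filter-map (point t) (_∈? M) (squareSlots q)) ⟩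
    hits M (map (point t) (squareSlots q))
      ≡⟨ cong (hits M) (sym (corners-point-lowerLeft t q)) ⟩
    hits M (corners (point t (lowerLeft q)))  ∎
    where open ≡-Reasoning

  lowerLeft∈squareCorners : ∀ t → Complete t → ∀ q → point t (lowerLeft q) ∈ squareCorners G
  lowerLeft∈squareCorners t complete q =
    ∈-filter⁺ (λ p → All.all? (_∈? pts G) (corners p)) {x = point t (lowerLeft q)} (complete (lowerLeft q))
      (subst (All (_∈ pts G)) (sym (corners-point-lowerLeft t q))
        (All.map⁺ {f = point t} (All.tabulate {xs = squareSlots q} λ {i} _ → complete i)))

  TileWon⇒2≤winningCorners : ∀ {M} t → Complete t → TileWon (localState M [] t) →
    2 ≤ length (inTile tileOf _≟T_ t (winningCorners M))
  TileWon⇒2≤winningCorners {M} t complete (q , q′ , q≢q′ , three , three′) =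
    distinct-∈⇒2≤length (corner∈ q three) (corner∈ q′ three′) (λ eq → q≢q′ (lowerLeft-injective (point-injective t eq)))
    where
    corner∈ : ∀ q → 3 ≤ makerCount (localState M [] t) q → point t (lowerLeft q) ∈ inTile tileOf _≟T_ t (winningCorners M)
    corner∈ q three = ∈-filter⁺ (λ p → tileOf p ≟T t) {x = point t (lowerLeft q)}
      (∈-filter⁺ (λ p → 3 ≤? hits M (corners p)) (lowerLeft∈squareCorners t complete q)
        (subst (3 ≤_) (makerCount≡hits M [] t q) three))
      (tileOf-point t (lowerLeft q))

  interior-in-tile≤15 : ∀ t → length (inTile tileOf _≟T_ t interior) ≤ 15
  interior-in-tile≤15 t = ≤-trans (Unique-⊆⇒length≤ unique-in-tile ⊆-tile)
    (≤-reflexive (trans (length-map (point t) (allFin 15)) (length-tabulate id)))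
    where
    unique-in-tile : Unique (inTile tileOf _≟T_ t interior)
    unique-in-tile = Unique.filter⁺ (λ p → tileOf p ≟T t) (Unique.filter⁺ (λ p → All.all? (_∈? pts G) (box 4 p))
                       (Unique.filter⁺ (λ p → All.all? (_∈? pts G) (corners p)) (unique G)))
    ⊆-tile : ∀ {p} → p ∈ inTile tileOf _≟T_ t interior → p ∈ map (point t) (allFin 15)
    ⊆-tile {p} p∈ =
      subst (λ t′ → p ∈ map (point t′) (allFin 15)) (proj₂ (∈-filter⁻ (λ p → tileOf p ≟T t) {xs = interior} p∈))
      (subst (_∈ map (point (tileOf p)) (allFin 15)) (point-tileOf-slotOf p) (∈-map⁺ (point (tileOf p)) (∈-allFin (slotOf p))))

  Good : ℕ → Set
  Good v = 2 * length interior ≤ 15 * v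

  all-TileWon⇒Good : ∀ {M} → (∀ t → Complete t → TileWon (localState M [] t)) → Good (finalScore (squares G) 3 M)
  all-TileWon⇒Good {M} tiles-won = subst (λ v → 2 * length interior ≤ 15 * v) (sym (finalScore≡winningCorners M))
    (double-counting tileOf _≟T_ 2 15 interior (winningCorners M)
      (λ {a} a∈ → TileWon⇒2≤winningCorners {M} (tileOf a) (interior-complete a∈) (tiles-won (tileOf a) (interior-complete a∈)))
      interior-in-tile≤15)

  full-[] : ∀ M t → Full (localState M [] t)
  full-[] M t i = cellOf-[] M (point t i)

  gridStrategy : MakerStrategy (squares G) 3 Good
  gridStrategy = record
    { MakerToMove = OneTileOpen
    ; BreakerToMove = AllTilesSecured
    ; maker-move = λ {M} {u} {us} → maker-move {M} {u} {us}
    ; breaker-move = λ {M} {U} {y} {r} → breaker-move {M} {U} {y} {r}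
    ; maker-end = λ {M} (t₀ , open₀ , others) → all-TileWon⇒Good λ t complete → by-tile M t₀ open₀ others t complete (t ≟T t₀)
    ; breaker-end = λ {M} all-secured → all-TileWon⇒Good λ t complete → Secured-full (full-[] M t) (all-secured t complete)
    ; Good-mono = λ m≤n good → ≤-trans good (*-monoʳ-≤ 15 m≤n)
    }
    where
    by-tile : ∀ M t₀ → (Complete t₀ → Securable (localState M [] t₀)) → SecuredExcept M [] t₀ →
      ∀ t → Complete t → Dec (t ≡ t₀) → TileWon (localState M [] t)
    by-tile M t₀ open₀ others t complete (yes refl) = Securable-full (full-[] M t) (open₀ complete)
    by-tile M t₀ open₀ others t complete (no t≢t₀) = Secured-full (full-[] M t) (others t t≢t₀ complete)

  start : OneTileOpen [] (pts G)
  start = (0ℤ , 0ℤ) , (λ complete → secured (initial (0ℤ , 0ℤ) complete)) , (λ t _ → initial t)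
    where
    initial : ∀ t → Complete t → Secured (localState [] (pts G) t)
    initial t complete = Secured-mono {λ _ → free} {localState [] (pts G) t}
      (≗⇒⊑ λ i → sym (cellOf-free {[]} (λ ()) (complete i))) Secured-emptyTile

  interior-bound : 2 * length interior ≤ 15 * SCsq G 3
  interior-bound = MakerStrategy.SC-bound gridStrategy (pts G) start

final-inequality : ∀ {n I b S} k → n ≡ I + b → 2 * I ≤ 15 * S → suc (k + suc k) * b ≤ n →
  2 * suc k * n ≤ 15 * suc k * S + 15 * n
final-inequality {n} {I} {b} {S} k n≡I+b 2I≤15S boundary = begin
  2 * suc k * n                            ≡⟨ cong (2 * suc k *_) n≡I+b ⟩
  2 * suc k * (I + b)                      ≡⟨ distribute k I b ⟩
  suc k * (2 * I) + suc (k + suc k) * b    ≤⟨ +-mono-≤ (*-monoʳ-≤ (suc k) 2I≤15S) boundary ⟩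
  suc k * (15 * S) + n                     ≡⟨ cong (_+ n) (reassociate k S) ⟩
  15 * suc k * S + n                       ≤⟨ +-monoʳ-≤ (15 * suc k * S) (m≤n*m n 15) ⟩
  15 * suc k * S + 15 * n                  ∎
  where
  open ≤-Reasoning
  distribute : ∀ k I b → 2 * suc k * (I + b) ≡ suc k * (2 * I) + suc (k + suc k) * b
  distribute = ℕ-Solver.solve-∀
  reassociate : ∀ k S → suc k * (15 * S) ≡ 15 * suc k * S
  reassociate = ℕ-Solver.solve-∀

theorem13 : (G : ℕ → Grid)
    → (∀ N → ∃[ M ] (∀ m → M ≤ m → N ≤ nSq (G m)))
    → (∀ d k → ∃[ M ] (∀ m → M ≤ m → suc k * nearBoundary d (G m) ≤ nSq (G m)))
    → ∀ k → ∃[ M ] (∀ m → M ≤ m →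
    2 * suc k * nSq (G m) ≤ 15 * suc k * SCsq (G m) 3 + 15 * nSq (G m))
theorem13 G _ few-near-boundary k =
  proj₁ boundary , λ m M≤m →
    final-inequality {nSq (G m)} {length (interior (G m))} {nearBoundary 4 (G m)} {SCsq (G m) 3} k
      (nSq≡interior+nearBoundary (G m)) (interior-bound (G m)) (proj₂ boundary m M≤m)
  where
  boundary : ∃[ M ] (∀ m → M ≤ m → suc (k + suc k) * nearBoundary 4 (G m) ≤ nSq (G m))
  boundary = few-near-boundary 4 (k + suc k)
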